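{- Let $U$ and $R$ be finite sets, let $\Gamma$ be a finite group acting on $U$, let $u_1,\ldots,u_k$ be distinct elements of $U$, put $U_j=\{u_1,\ldots,u_j\}$, and fix $j\in\{1,\ldots,k\}$. Fix a canonical labeling map $\kappa:\Omega_j\to\Gamma$, a total order on $U$, and for each $p\in u_j^{\mathrm{Aut}(U_{j-1})}$ an element $\nu(p)\in\mathrm{Aut}(U_{j-1})$ with $p^{\nu(p)}=u_j$. Let $\mathcal{S}$ be a set of normalized assignments in $\Omega_{j-1}$ containing exactly one element from each orbit of $\Gamma$ on $\Omega_{j-1}$. For each $S\in\mathcal{S}$, each $p\in u_j^{\mathrm{Aut}(U_{j-1})}$ and each $r\in R$, let $X=X_{S,p,r}:U_{j-1}\cup\{p\}\to R$ be defined by $X(p)=r$ and $X(u)=S(u)$ for $u\in U_{j-1}$, and call $(S,p,r)$ accepted if both of the following tests pass: (T1') letting $q$ be the minimum element of $U$ (in the fixed order) such that $q^{\kappa(X)^{ -1}\nu(p)}\in u_j^{\mathrm{Aut}(U_j)}$, there exists $\alpha\in\mathrm{Aut}(X)$ with $p^\alpha=q^{\kappa(X)^{ -1}}$; (T2') $p$ is the minimum element (in the fixed order on $U$) of the orbit $p^{\mathrm{Aut}(S)}$. Then, over all accepted triples $(S,p,r)$, the assignments $X_{S,p,r}^{\nu(p)}$ (which are normalized elements of $\Omega_j$) meet every orbit of $\Gamma$ on $\Omega_j$ exactly once; that is, every $\Gamma$-orbit on $\Omega_j$ contains $X_{S,p,r}^{\nu(p)}$ for exactly one accepted triple $(S,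p,r)$.
   Context: $\Gamma$ acts on $U$ from the right, written $u^\gamma$ (so $u^{\beta\gamma}=(u^\beta)^\gamma$), and on subsets $W\subseteq U$ elementwise, $W^\gamma=\{w^\gamma:w\in W\}$. A partial assignment is a map $X:W\to R$ with $W\subseteq U$; write $\underline{X}=W$. $\Gamma$ acts on partial assignments by $X^\gamma:W^\gamma\to R$, $X^\gamma(u)=X(u^{\gamma^{ -1}})$ for $u\in W^\gamma$. For any object $Y$ acted on by $\Gamma$ (an element or subset of $U$, or a partial assignment), $\mathrm{Aut}(Y)=\{\gamma\in\Gamma:Y^\gamma=Y\}$, and for a subgroup $\Lambda\le\Gamma$, $Y^\Lambda=\{Y^\lambda:\lambda\in\Lambda\}$. For $j=0,\ldots,k$ (with $U_0=\emptyset$), $\Omega_j$ is the set of all partial assignments $X$ with $\underline{X}=U_j^\gamma$ for some $\gamma\in\Gamma$, and $X\in\Omega_j$ is normalized if $\underline{X}=U_j$. A canonical labeling map $\kappa:\Omega_j\to\Gamma$ is a function such that for all $X,Y\in\Omega_j$, if $Y=X^\gamma$ for some $\gamma\in\Gamma$ then $X^{\kappa(X)}=Y^{\kappa(Y)}$. -}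

module Defs where

open import Level using (0ℓ)
open import Algebra.Bundles using (Group)
open import Data.Nat using (ℕ; _<_; _≤_)
open import Data.Fin using (Fin; toℕ; _≟_)
open import Data.Maybe using (Maybe; just; nothing)
open import Data.Product using (Σ; ∃; _×_; _,_)
open import Relation.Binary.PropositionalEquality using (_≡_)
open import Relation.Nullary using (¬_; yes; no)

FiniteGroup : Group 0ℓ 0ℓ → Set
FiniteGroup G = Σ ℕ λ m → Σ (Fin m → Carrier) λ f → ∀ g → ∃ λ i → f i ≈ g
  where open Group G

-- A right action of G on U = Fin n, written act u γ = u^γ.
record RightAction (G : Group 0ℓ 0ℓ) (n : ℕ) : Set where
  open Group G
  field
    act      : Fin n → Carrier → Fin n
    act-ε    : ∀ u → act u ε ≡ u
    act-∙    : ∀ u β γ → act u (β ∙ γ) ≡ act (act u β) γ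
    act-cong : ∀ u {β γ} → β ≈ γ → act u β ≡ act u γ

module Ctx {G : Group 0ℓ 0ℓ} {nU : ℕ} (nR : ℕ) (A : RightAction G nU) where
  open Group G
  open RightAction A

  U : Set
  U = Fin nU

  R : Set
  R = Fin nR

  SubsetU : Set₁
  SubsetU = U → Set

  -- partial assignments X : W → R, W ⊆ U, as U → Maybe R (domain = where defined)
  PAssign : Set
  PAssign = U → Maybe R

  dom : PAssign → SubsetU
  dom X v = ∃ λ r → X v ≡ just r

  _^ˢ_ : SubsetU → Carrier → SubsetU
  (W ^ˢ γ) v = ∃ λ w → W w × act w γ ≡ v

  _≐ˢ_ : SubsetU → SubsetU → Set
  W ≐ˢ V = ∀ v → (W v → V v) × (V v → W v)

  _^ᵃ_ : PAssign → Carrier → PAssign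
  (X ^ᵃ γ) v = X (act v (γ ⁻¹))

  _≐_ : PAssign → PAssign → Set
  X ≐ Y = ∀ v → X v ≡ Y v

  AutSet : SubsetU → Carrier → Set
  AutSet W γ = (W ^ˢ γ) ≐ˢ W

  AutAss : PAssign → Carrier → Set
  AutAss X γ = (X ^ᵃ γ) ≐ X

  InOrbit : (Carrier → Set) → U → U → Set
  InOrbit P x y = ∃ λ γ → P γ × act x γ ≡ y

  SameOrbit : PAssign → PAssign → Set
  SameOrbit X Y = ∃ λ γ → Y ≐ (X ^ᵃ γ)

  Ω : SubsetU → PAssign → Set
  Ω W X = ∃ λ γ → dom X ≐ˢ (W ^ˢ γ)

  IsCanonicalLabeling : SubsetU → (PAssign → Carrier) → Set
  IsCanonicalLabeling W κ =
    ∀ X Y → Ω W X → Ω W Y → ∀ γ → Y ≐ (X ^ᵃ γ) → (X ^ᵃ κ X) ≐ (Y ^ᵃ κ Y)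

  IsMinimum : (U → U → Set) → (U → Set) → U → Set
  IsMinimum _≺_ P q = P q × (∀ q' → P q' → ¬ (q' ≺ q))

  -- Data of the specific step j. Indices are 0-based: u : Fin k → U,
  -- and the paper's j ∈ {1..k} is represented by j : Fin k with u_j = u j.
  module Step {k : ℕ} (u : Fin k → U) (j : Fin k) where
    Uj : SubsetU
    Uj v = ∃ λ i → toℕ i ≤ toℕ j × u i ≡ v

    Ujm1 : SubsetU
    Ujm1 v = ∃ λ i → toℕ i < toℕ j × u i ≡ v

    uj : U
    uj = u j

    Candidate : U → Set
    Candidate p = InOrbit (AutSet Ujm1) uj p

    ext : PAssign → U → R → PAssign
    ext S p r v with p ≟ v
    ... | yes _ = just r
    ... | no _  = S v

    module Tests (_≺_ : U → U → Set) (κ : PAssign → Carrier) (ν : U → Carrier)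
                 (𝒮 : PAssign → Set) where
      T1 : PAssign → U → R → Set
      T1 S p r =
        let X = ext S p r in
        ∃ λ q → IsMinimum _≺_ (λ q' → InOrbit (AutSet Uj) uj (act q' ((κ X ⁻¹) ∙ ν p))) q
              × ∃ λ α → AutAss X α × act p α ≡ act q (κ X ⁻¹)

      T2 : PAssign → U → Set
      T2 S p = IsMinimum _≺_ (InOrbit (AutAss S) p) p

      Accepted : PAssign → U → R → Set
      Accepted S p r = 𝒮 S × Candidate p × T1 S p r × T2 S p

      rep : PAssign → U → R → PAssign
      rep S p r = ext S p r ^ᵃ ν p

module Submission where

open import Defs
open import Level using (0ℓ) renaming (suc to lsuc)
open import Algebra.Bundles using (Group)
import Algebra.Properties.Group as GroupProperties
open import Data.Nat using (ℕ)
import Data.Nat.Properties as ℕ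
open import Data.Fin using (Fin; toℕ; _≟_)
import Data.Fin.Properties as Fin
open import Data.Maybe using (just; nothing)
import Data.Maybe.Properties as Maybe
open import Data.List using (List; []; _∷_; allFin)
open import Data.List.Membership.Propositional using (_∈_)
open import Data.List.Membership.Propositional.Properties using (∈-allFin)
open import Data.List.Relation.Unary.Any using (here; there)
open import Data.Product using (∃; _×_; _,_; proj₁; proj₂)
open import Data.Sum using (_⊎_; inj₁; inj₂)
open import Data.Empty using (⊥-elim)
open import Function.Base using (case_of_)
open import Function.Definitions using (Injective)
open import Relation.Binary.Bundles using (Setoid)
open import Relation.Binary.Definitions using (tri<; tri≈; tri>)
open import Relation.Binary.PropositionalEquality
  using (_≡_; _≢_; refl; sym; trans; cong; subst; module ≡-Reasoning)
open import Relation.Binary.Structures using (IsStrictTotalOrder)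
import Relation.Binary.Reasoning.Setoid as SetoidReasoning
open import Relation.Nullary using (¬_; Dec; yes; no)
open import Relation.Nullary.Decidable using (_×-dec_; _→-dec_; map′)

-- The argument rests on one invariant: for a
-- well-formed extension X, test (T1') only depends on the Γ-orbit of X.  The
-- minimum q of test (T1') is orbit invariant because κ is a canonical
-- labeling, and the "anchor" q^{κ(X)⁻¹} moves along with X (anchored-transport);
-- moreover all points anchored in X form one Aut(X)-orbit (anchored-unique).
--
-- Uniqueness: two accepted triples in one orbit give X' = X^e with p^e = p';
-- comparing the two sides of the extension gives S' = S^e, r = r', so S = S'
-- (𝒮 has one element per orbit), e ∈ Aut(S), and (T2') forces p = p'.
-- Existence: every Y ∈ Ω_j is in the orbit of some X_{S,p,r} with S ∈ 𝒮
-- (normal-form); renormalising X so that its anchor becomes the extension point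
-- makes (T1') hold (fix-T1), and moving p to the minimum of p^{Aut(S)} makes
-- (T2') hold without breaking (T1') (fix-T2).

module Theory (G : Group 0ℓ 0ℓ) {nU : ℕ} (nR : ℕ) (A : RightAction G nU) where
  open Group G using (Carrier; _≈_; _∙_; ε; _⁻¹; inverseˡ; inverseʳ; ⁻¹-cong)
    renaming (sym to ≈-sym)
  open GroupProperties G using (⁻¹-involutive; ⁻¹-anti-homo-∙; ε⁻¹≈ε)
  open RightAction A
  open Ctx nR A

  act-inverseʳ : ∀ v γ → act (act v γ) (γ ⁻¹) ≡ v
  act-inverseʳ v γ = trans (sym (act-∙ v γ (γ ⁻¹))) (trans (act-cong v (inverseʳ γ)) (act-ε v))

  act-inverseˡ : ∀ v γ → act (act v (γ ⁻¹)) γ ≡ v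
  act-inverseˡ v γ = trans (sym (act-∙ v (γ ⁻¹) γ)) (trans (act-cong v (inverseˡ γ)) (act-ε v))

  act-back : ∀ {v w} γ → act v γ ≡ w → act w (γ ⁻¹) ≡ v
  act-back {v} γ refl = act-inverseʳ v γ

  act-injective : ∀ {v w} γ → act v γ ≡ act w γ → v ≡ w
  act-injective {v} {w} γ e = trans (sym (act-back γ e)) (act-inverseʳ w γ)

  ≐ˢ-setoid : Setoid (lsuc 0ℓ) 0ℓ
  ≐ˢ-setoid = record
    { Carrier = SubsetU
    ; _≈_ = _≐ˢ_
    ; isEquivalence = record
      { refl = λ v → (λ h → h) , (λ h → h)
      ; sym = λ e v → proj₂ (e v) , proj₁ (e v)
      ; trans = λ e f v → (λ h → proj₁ (f v) (proj₁ (e v) h)) , (λ h → proj₂ (e v) (proj₂ (f v) h))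
      }
    }
  open Setoid ≐ˢ-setoid public using ()
    renaming (sym to ≐ˢ-sym; trans to ≐ˢ-trans)

  preimage : SubsetU → Carrier → SubsetU
  preimage W γ w = W (act w γ)

  subset-≡ : ∀ (W : SubsetU) {v w} → v ≡ w → (W v → W w) × (W w → W v)
  subset-≡ W e = subst W e , subst W (sym e)

  preimage-cong : ∀ {W V} γ → W ≐ˢ V → preimage W γ ≐ˢ preimage V γ
  preimage-cong γ e w = e (act w γ)

  preimage-≈ : ∀ W {β γ} → β ≈ γ → preimage W β ≐ˢ preimage W γ
  preimage-≈ W e w = subset-≡ W (act-cong w e)

  preimage-ε : ∀ W → preimage W ε ≐ˢ W
  preimage-ε W w = subset-≡ W (act-ε w)

  preimage-∙ : ∀ W β γ → preimage W (β ∙ γ) ≐ˢ preimage (preimage W γ) β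
  preimage-∙ W β γ w = subset-≡ W (act-∙ w β γ)

  preimage-inverseˡ : ∀ W γ → preimage (preimage W γ) (γ ⁻¹) ≐ˢ W
  preimage-inverseˡ W γ w = subset-≡ W (act-inverseˡ w γ)

  preimage-inverseʳ : ∀ W γ → preimage (preimage W (γ ⁻¹)) γ ≐ˢ W
  preimage-inverseʳ W γ w = subset-≡ W (act-inverseʳ w γ)

  image-preimage : ∀ W γ → (W ^ˢ γ) ≐ˢ preimage W (γ ⁻¹)
  image-preimage W γ v =
    (λ { (w , w∈W , refl) → subst W (sym (act-inverseʳ w γ)) w∈W })
    , (λ h → act v (γ ⁻¹) , h , act-inverseˡ v γ)

  -- γ preserves W pointwise; this is AutSet W γ in a form that composes easily.
  Preserves : SubsetU → Carrier → Set
  Preserves W γ = preimage W γ ≐ˢ W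

  preserves⇒aut : ∀ {W γ} → Preserves W γ → AutSet W γ
  preserves⇒aut {W} {γ} pres = begin
    W ^ˢ γ                              ≈⟨ image-preimage W γ ⟩
    preimage W (γ ⁻¹)                   ≈⟨ preimage-cong (γ ⁻¹) pres ⟨
    preimage (preimage W γ) (γ ⁻¹)      ≈⟨ preimage-inverseˡ W γ ⟩
    W                                   ∎
    where open SetoidReasoning ≐ˢ-setoid

  aut⇒preserves : ∀ {W γ} → AutSet W γ → Preserves W γ
  aut⇒preserves {W} {γ} aut = begin
    preimage W γ                        ≈⟨ preimage-cong γ (≐ˢ-trans (≐ˢ-sym aut) (image-preimage W γ)) ⟩
    preimage (preimage W (γ ⁻¹)) γ      ≈⟨ preimage-inverseʳ W γ ⟩
    W                                   ∎
    where open SetoidReasoning ≐ˢ-setoid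

  preserves-∙ : ∀ {W β γ} → Preserves W β → Preserves W γ → Preserves W (β ∙ γ)
  preserves-∙ {W} {β} {γ} pβ pγ =
    ≐ˢ-trans (preimage-∙ W β γ) (≐ˢ-trans (preimage-cong β pγ) pβ)

  preserves-⁻¹ : ∀ {W γ} → Preserves W γ → Preserves W (γ ⁻¹)
  preserves-⁻¹ {W} {γ} pγ = ≐ˢ-trans (preimage-cong (γ ⁻¹) (≐ˢ-sym pγ)) (preimage-inverseˡ W γ)

  record IsSubgroup (P : Carrier → Set) : Set where
    field
      has-ε   : P ε
      has-∙   : ∀ {β γ} → P β → P γ → P (β ∙ γ)
      has-⁻¹  : ∀ {γ} → P γ → P (γ ⁻¹)
      resp-≈  : ∀ {β γ} → β ≈ γ → P β → P γ

  module Orbits {P : Carrier → Set} (sub : IsSubgroup P) where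
    open IsSubgroup sub

    orbit-refl : ∀ x → InOrbit P x x
    orbit-refl x = ε , has-ε , act-ε x

    orbit-sym : ∀ {x y} → InOrbit P x y → InOrbit P y x
    orbit-sym {x} (γ , Pγ , refl) = γ ⁻¹ , has-⁻¹ Pγ , act-inverseʳ x γ

    orbit-trans : ∀ {x y z} → InOrbit P x y → InOrbit P y z → InOrbit P x z
    orbit-trans {x} (β , Pβ , refl) (γ , Pγ , refl) = β ∙ γ , has-∙ Pβ Pγ , act-∙ x β γ

  autSet-subgroup : ∀ W → IsSubgroup (AutSet W)
  autSet-subgroup W = record
    { has-ε  = preserves⇒aut (preimage-ε W)
    ; has-∙  = λ a b → preserves⇒aut (preserves-∙ (aut⇒preserves a) (aut⇒preserves b))
    ; has-⁻¹ = λ a → preserves⇒aut (preserves-⁻¹ (aut⇒preserves a))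
    ; resp-≈ = λ e a → preserves⇒aut (≐ˢ-trans (preimage-≈ W (≈-sym e)) (aut⇒preserves a))
    }

  -- Retargeting an orbit point: if c and c' pull W back to the same set, then
  -- c⁻¹c' preserves W, so q^c and q^{c'} lie in the same Aut(W)-orbits.
  orbit-retarget : ∀ W {c c'} → preimage W c ≐ˢ preimage W c' →
    ∀ {x} q → InOrbit (AutSet W) x (act q c) → InOrbit (AutSet W) x (act q c')
  orbit-retarget W {c} {c'} same q x∼qc =
    orbit-trans x∼qc (c ⁻¹ ∙ c' , preserves⇒aut pres , moves)
    where
    open Orbits (autSet-subgroup W)
    pres : Preserves W (c ⁻¹ ∙ c')
    pres = begin
      preimage W (c ⁻¹ ∙ c')               ≈⟨ preimage-∙ W (c ⁻¹) c' ⟩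
      preimage (preimage W c') (c ⁻¹)      ≈⟨ preimage-cong (c ⁻¹) same ⟨
      preimage (preimage W c) (c ⁻¹)       ≈⟨ preimage-inverseˡ W c ⟩
      W                                    ∎
      where open SetoidReasoning ≐ˢ-setoid
    moves : act (act q c) (c ⁻¹ ∙ c') ≡ act q c'
    moves = trans (act-∙ (act q c) (c ⁻¹) c') (cong (λ z → act z c') (act-inverseʳ q c))

  ≐-setoid : Setoid 0ℓ 0ℓ
  ≐-setoid = record
    { Carrier = PAssign
    ; _≈_ = _≐_
    ; isEquivalence = record
      { refl = λ v → refl
      ; sym = λ e v → sym (e v)
      ; trans = λ e f v → trans (e v) (f v)
      }
    }
  open Setoid ≐-setoid public using ()
    renaming (refl to ≐-refl; sym to ≐-sym; trans to ≐-trans)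

  ^ᵃ-cong : ∀ {X Y} γ → X ≐ Y → (X ^ᵃ γ) ≐ (Y ^ᵃ γ)
  ^ᵃ-cong γ e v = e (act v (γ ⁻¹))

  ^ᵃ-∙ : ∀ X β γ → (X ^ᵃ (β ∙ γ)) ≐ ((X ^ᵃ β) ^ᵃ γ)
  ^ᵃ-∙ X β γ v = cong X (trans (act-cong v (⁻¹-anti-homo-∙ β γ)) (act-∙ v (γ ⁻¹) (β ⁻¹)))

  ^ᵃ-ε : ∀ X → (X ^ᵃ ε) ≐ X
  ^ᵃ-ε X v = cong X (trans (act-cong v ε⁻¹≈ε) (act-ε v))

  ^ᵃ-inverse : ∀ X γ → ((X ^ᵃ γ) ^ᵃ (γ ⁻¹)) ≐ X
  ^ᵃ-inverse X γ v =
    cong X (trans (cong (λ z → act z (γ ⁻¹)) (act-cong v (⁻¹-involutive γ))) (act-inverseʳ v γ))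

  dom-cong : ∀ {X Y} → X ≐ Y → dom X ≐ˢ dom Y
  dom-cong e v = (λ { (r , x) → r , trans (sym (e v)) x }) , (λ { (r , y) → r , trans (e v) y })

  orbit-setoid : Setoid 0ℓ 0ℓ
  orbit-setoid = record
    { Carrier = PAssign
    ; _≈_ = SameOrbit
    ; isEquivalence = record
      { refl = λ {X} → ε , ≐-sym (^ᵃ-ε X)
      ; sym = λ { {X} (β , Y≐) → β ⁻¹ , ≐-trans (≐-sym (^ᵃ-inverse X β)) (^ᵃ-cong (β ⁻¹) (≐-sym Y≐)) }
      ; trans = λ { {X} (β , Y≐) (γ , Z≐) → β ∙ γ , ≐-trans Z≐ (≐-trans (^ᵃ-cong γ Y≐) (≐-sym (^ᵃ-∙ X β γ))) }
      }
    }
  open Setoid orbit-setoid public using ()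
    renaming (sym to sameOrbit-sym)
  module OrbitReasoning = SetoidReasoning orbit-setoid

  autAss-subgroup : ∀ X → IsSubgroup (AutAss X)
  autAss-subgroup X = record
    { has-ε  = ^ᵃ-ε X
    ; has-∙  = λ {β} {γ} a b → ≐-trans (^ᵃ-∙ X β γ) (≐-trans (^ᵃ-cong γ a) b)
    ; has-⁻¹ = λ {γ} a → ≐-trans (^ᵃ-cong (γ ⁻¹) (≐-sym a)) (^ᵃ-inverse X γ)
    ; resp-≈ = λ e a v → trans (cong X (act-cong v (⁻¹-cong (≈-sym e)))) (a v)
    }

  autOrbit-between : ∀ {X Y β γ} → Y ≐ (X ^ᵃ β) → Y ≐ (X ^ᵃ γ) →
    ∀ a → InOrbit (AutAss Y) (act a β) (act a γ)
  autOrbit-between {X} {Y} {β} {γ} Y≐Xβ Y≐Xγ a = β ⁻¹ ∙ γ , aut , moves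
    where
    aut : AutAss Y (β ⁻¹ ∙ γ)
    aut = begin
      Y ^ᵃ (β ⁻¹ ∙ γ)           ≈⟨ ^ᵃ-∙ Y (β ⁻¹) γ ⟩
      (Y ^ᵃ (β ⁻¹)) ^ᵃ γ        ≈⟨ ^ᵃ-cong γ (^ᵃ-cong (β ⁻¹) Y≐Xβ) ⟩
      ((X ^ᵃ β) ^ᵃ (β ⁻¹)) ^ᵃ γ ≈⟨ ^ᵃ-cong γ (^ᵃ-inverse X β) ⟩
      X ^ᵃ γ                    ≈⟨ Y≐Xγ ⟨
      Y                         ∎
      where open SetoidReasoning ≐-setoid
    moves : act (act a β) (β ⁻¹ ∙ γ) ≡ act a γ
    moves = trans (act-∙ (act a β) (β ⁻¹) γ) (cong (λ z → act z γ) (act-inverseʳ a β))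

  autOrbit-conj : ∀ {X Y g a b} → Y ≐ (X ^ᵃ g) →
    InOrbit (AutAss X) a b → InOrbit (AutAss Y) (act a g) (act b g)
  autOrbit-conj {X} {Y} {g} {a} Y≐Xg (α , α∈AutX , refl) =
    subst (InOrbit (AutAss Y) (act a g)) (act-∙ a α g) (autOrbit-between {X} Y≐Xg Y≐Xαg a)
    where
    Y≐Xαg : Y ≐ (X ^ᵃ (α ∙ g))
    Y≐Xαg = ≐-trans Y≐Xg (≐-trans (^ᵃ-cong g (≐-sym α∈AutX)) (≐-sym (^ᵃ-∙ X α g)))

  autOrbit-cong : ∀ {X Y a b} → X ≐ Y → InOrbit (AutAss X) a b → InOrbit (AutAss Y) a b
  autOrbit-cong X≐Y (γ , γ∈AutX , a↦b) =
    γ , ≐-trans (^ᵃ-cong γ (≐-sym X≐Y)) (≐-trans γ∈AutX X≐Y) , a↦b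

  autOrbit-align : ∀ {X Y m a b} → Y ≐ (X ^ᵃ m) → InOrbit (AutAss Y) (act a m) b →
    ∃ λ e → Y ≐ (X ^ᵃ e) × act a e ≡ b
  autOrbit-align {X} {Y} {m} {a} Y≐Xm (β , β∈AutY , am↦b) =
    m ∙ β , Y≐Xmβ , trans (act-∙ a m β) am↦b
    where
    Y≐Xmβ : Y ≐ (X ^ᵃ (m ∙ β))
    Y≐Xmβ = ≐-trans (≐-sym β∈AutY) (≐-trans (^ᵃ-cong β Y≐Xm) (≐-sym (^ᵃ-∙ X m β)))

  -- A map from X to X', read off from a path X → X^a → (X^a)^b = X'^g ← X'.
  ^ᵃ-path : ∀ {X X'} a b g → (X' ^ᵃ g) ≐ ((X ^ᵃ a) ^ᵃ b) → X' ≐ (X ^ᵃ ((a ∙ b) ∙ g ⁻¹))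
  ^ᵃ-path {X} {X'} a b g X'g≐Xab = begin
    X'                          ≈⟨ ^ᵃ-inverse X' g ⟨
    (X' ^ᵃ g) ^ᵃ (g ⁻¹)         ≈⟨ ^ᵃ-cong (g ⁻¹) X'g≐Xab ⟩
    ((X ^ᵃ a) ^ᵃ b) ^ᵃ (g ⁻¹)   ≈⟨ ^ᵃ-cong (g ⁻¹) (^ᵃ-∙ X a b) ⟨
    (X ^ᵃ (a ∙ b)) ^ᵃ (g ⁻¹)    ≈⟨ ^ᵃ-∙ X (a ∙ b) (g ⁻¹) ⟨
    X ^ᵃ ((a ∙ b) ∙ g ⁻¹)       ∎
    where open SetoidReasoning ≐-setoid

  -- The same path for points: t ↦ t^a = w^β ↦ w = p'^g ↤ p'.
  act-path : ∀ {t w p'} a β g → act t a ≡ act w β → act p' g ≡ w → act t ((a ∙ β ⁻¹) ∙ g ⁻¹) ≡ p'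
  act-path {t} {w} {p'} a β g t↦ p'↦w = begin
    act t ((a ∙ β ⁻¹) ∙ g ⁻¹)                ≡⟨ act-∙ t (a ∙ β ⁻¹) (g ⁻¹) ⟩
    act (act t (a ∙ β ⁻¹)) (g ⁻¹)            ≡⟨ cong (λ z → act z (g ⁻¹)) (act-∙ t a (β ⁻¹)) ⟩
    act (act (act t a) (β ⁻¹)) (g ⁻¹)        ≡⟨ cong (λ z → act (act z (β ⁻¹)) (g ⁻¹)) t↦ ⟩
    act (act (act w β) (β ⁻¹)) (g ⁻¹)        ≡⟨ cong (λ z → act z (g ⁻¹)) (act-inverseʳ w β) ⟩
    act w (g ⁻¹)                             ≡⟨ act-back g p'↦w ⟩
    p'                                       ∎
    where open ≡-Reasoning

  -- If γ moves X to an assignment with the same domain W, then γ⁻¹ ∈ Aut(W);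
  -- recall that dom (X^γ) is by definition preimage (dom X) γ⁻¹.
  domain-aut : ∀ {X W γ} → dom X ≐ˢ W → dom (X ^ᵃ γ) ≐ˢ W → AutSet W (γ ⁻¹)
  domain-aut {X} {W} {γ} domX domXγ =
    preserves⇒aut (≐ˢ-trans (preimage-cong (γ ⁻¹) (≐ˢ-sym domX)) domXγ)

  aut-domain : ∀ {X W γ} → dom X ≐ˢ W → AutAss X γ → AutSet W γ
  aut-domain {X} {W} {γ} domX γ∈AutX = resp-≈ (⁻¹-involutive γ) (domain-aut {X} domX domXγ⁻¹)
    where
    open IsSubgroup (autSet-subgroup W) using (resp-≈)
    domXγ⁻¹ : dom (X ^ᵃ (γ ⁻¹)) ≐ˢ W
    domXγ⁻¹ = ≐ˢ-trans (dom-cong (IsSubgroup.has-⁻¹ (autAss-subgroup X) γ∈AutX)) domX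

  dom-^ᵃ-aut : ∀ {Y W γ} → dom Y ≐ˢ W → AutSet W γ → dom (Y ^ᵃ γ) ≐ˢ W
  dom-^ᵃ-aut {Y} {W} {γ} domY γ∈AutW =
    ≐ˢ-trans (preimage-cong (γ ⁻¹) domY) (preserves-⁻¹ (aut⇒preserves γ∈AutW))

  Ω-intro : ∀ {X W} γ → dom X ≐ˢ preimage W γ → Ω W X
  Ω-intro {X} {W} γ domX = γ ⁻¹ , ≐ˢ-trans domX (≐ˢ-sym image)
    where
    image : (W ^ˢ (γ ⁻¹)) ≐ˢ preimage W γ
    image = ≐ˢ-trans (image-preimage W (γ ⁻¹)) (preimage-≈ W (⁻¹-involutive γ))

  Ω-normalize : ∀ {Y W γ} → dom Y ≐ˢ (W ^ˢ γ) → dom (Y ^ᵃ (γ ⁻¹)) ≐ˢ W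
  Ω-normalize {Y} {W} {γ} domY = begin
    preimage (dom Y) (γ ⁻¹ ⁻¹)                ≈⟨ preimage-cong (γ ⁻¹ ⁻¹) domY ⟩
    preimage (W ^ˢ γ) (γ ⁻¹ ⁻¹)               ≈⟨ preimage-cong (γ ⁻¹ ⁻¹) (image-preimage W γ) ⟩
    preimage (preimage W (γ ⁻¹)) (γ ⁻¹ ⁻¹)    ≈⟨ preimage-inverseˡ W (γ ⁻¹) ⟩
    W                                         ∎
    where open SetoidReasoning ≐ˢ-setoid

  module Minima (_≺_ : U → U → Set) (sto : IsStrictTotalOrder _≡_ _≺_) where
    open IsStrictTotalOrder sto using (compare; irrefl) renaming (trans to ≺-trans)

    least-in : (P : U → Set) → (∀ x → Dec (P x)) → (L : List U) →
      (∀ b → b ∈ L → ¬ P b) ⊎ (∃ λ a → P a × (∀ b → b ∈ L → P b → ¬ (b ≺ a)))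
    least-in P P? [] = inj₁ (λ b ())
    least-in P P? (x ∷ xs) with P? x | least-in P P? xs
    ... | no ¬px | inj₁ none = inj₁ λ { b (here refl) → ¬px ; b (there m) → none b m }
    ... | no ¬px | inj₂ (a , pa , least) =
      inj₂ (a , pa , λ { b (here refl) pb → ⊥-elim (¬px pb) ; b (there m) → least b m })
    ... | yes px | inj₁ none =
      inj₂ (x , px , λ { b (here refl) _ → irrefl refl ; b (there m) pb → ⊥-elim (none b m pb) })
    ... | yes px | inj₂ (a , pa , least) with compare x a
    ...   | tri< x≺a _ _ =
      inj₂ (x , px , λ { b (here refl) _ → irrefl refl
                       ; b (there m) pb b≺x → least b m pb (≺-trans b≺x x≺a) })
    ...   | tri≈ _ x≡a _ = inj₂ (a , pa , λ { b (here refl) _ → irrefl x≡a ; b (there m) → least b m })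
    ...   | tri> _ _ a≺x =
      inj₂ (a , pa , λ { b (here refl) _ b≺a → irrefl refl (≺-trans a≺x b≺a) ; b (there m) → least b m })

    minimum-exists : (P : U → Set) → (∀ x → Dec (P x)) → ∀ x → P x → ∃ (IsMinimum _≺_ P)
    minimum-exists P P? x px with least-in P P? (allFin nU)
    ... | inj₁ none = ⊥-elim (none x (∈-allFin x) px)
    ... | inj₂ (a , pa , least) = a , pa , λ b pb → least b (∈-allFin b) pb

    minimum-unique : ∀ {P a b} → IsMinimum _≺_ P a → IsMinimum _≺_ P b → a ≡ b
    minimum-unique {a = a} {b} (pa , a-least) (pb , b-least) with compare a b
    ... | tri< a≺b _ _ = ⊥-elim (b-least a pa a≺b)
    ... | tri≈ _ a≡b _ = a≡b
    ... | tri> _ _ b≺a = ⊥-elim (a-least b pb b≺a)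

    minimum-cong : ∀ {P Q a} → (∀ q → P q → Q q) → (∀ q → Q q → P q) →
      IsMinimum _≺_ P a → IsMinimum _≺_ Q a
    minimum-cong P⊆Q Q⊆P (pa , least) = P⊆Q _ pa , λ q qq → least q (Q⊆P q qq)

    orbit-minimum-move : ∀ {P a b c} → IsSubgroup P → InOrbit P a b →
      IsMinimum _≺_ (InOrbit P a) c → IsMinimum _≺_ (InOrbit P b) c
    orbit-minimum-move sub a∼b =
      minimum-cong (λ _ → orbit-trans (orbit-sym a∼b)) (λ _ → orbit-trans a∼b)
      where open Orbits sub

    orbit-minimum-unique : ∀ {P a b} → IsSubgroup P → InOrbit P a b →
      IsMinimum _≺_ (InOrbit P a) a → IsMinimum _≺_ (InOrbit P b) b → a ≡ b
    orbit-minimum-unique sub a∼b a-min b-min =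
      minimum-unique a-min (orbit-minimum-move sub (Orbits.orbit-sym sub a∼b) b-min)

  module Finite (fin : FiniteGroup G) where
    enumerate : Fin (proj₁ fin) → Carrier
    enumerate = proj₁ (proj₂ fin)

    enumerate-onto : ∀ γ → ∃ λ i → enumerate i ≈ γ
    enumerate-onto = proj₂ (proj₂ fin)

    orbit-dec : ∀ {P} → IsSubgroup P → (∀ γ → Dec (P γ)) → ∀ x y → Dec (InOrbit P x y)
    orbit-dec {P} sub P? x y =
      map′ found search (Fin.any? λ i → P? (enumerate i) ×-dec (act x (enumerate i) ≟ y))
      where
      found : (∃ λ i → P (enumerate i) × act x (enumerate i) ≡ y) → InOrbit P x y
      found (i , Pγ , x↦y) = enumerate i , Pγ , x↦y
      search : InOrbit P x y → ∃ λ i → P (enumerate i) × act x (enumerate i) ≡ y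
      search (γ , Pγ , x↦y) with enumerate-onto γ
      ... | i , γᵢ≈γ = i , IsSubgroup.resp-≈ sub (≈-sym γᵢ≈γ) Pγ , trans (act-cong x γᵢ≈γ) x↦y

    autSet-dec : ∀ W → (∀ v → Dec (W v)) → ∀ γ → Dec (AutSet W γ)
    autSet-dec W W? γ = map′ preserves⇒aut aut⇒preserves
      (Fin.all? λ w → (W? (act w γ) →-dec W? w) ×-dec (W? w →-dec W? (act w γ)))

    autAss-dec : ∀ X γ → Dec (AutAss X γ)
    autAss-dec X γ = Fin.all? λ v → Maybe.≡-dec _≟_ (X (act v (γ ⁻¹))) (X v)

  module StepFacts {k : ℕ} (u : Fin k → U) (u-inj : Injective _≡_ _≡_ u) (j : Fin k) where
    open Step u j

    Uj-split : ∀ {v} → Uj v → v ≡ uj ⊎ Ujm1 v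
    Uj-split (i , i≤j , uᵢ≡v) with ℕ.m≤n⇒m<n∨m≡n i≤j
    ... | inj₁ i<j = inj₂ (i , i<j , uᵢ≡v)
    ... | inj₂ i≡j = inj₁ (trans (sym uᵢ≡v) (cong u (Fin.toℕ-injective i≡j)))

    uj∈Uj : Uj uj
    uj∈Uj = j , ℕ.≤-refl , refl

    Ujm1⊆Uj : ∀ {v} → Ujm1 v → Uj v
    Ujm1⊆Uj (i , i<j , uᵢ≡v) = i , ℕ.<⇒≤ i<j , uᵢ≡v

    uj∉Ujm1 : ¬ Ujm1 uj
    uj∉Ujm1 (i , i<j , uᵢ≡uj) = ℕ.<-irrefl (cong toℕ (u-inj uᵢ≡uj)) i<j

    Uj-dec : ∀ v → Dec (Uj v)
    Uj-dec v = Fin.any? λ i → (toℕ i ℕ.≤? toℕ j) ×-dec (u i ≟ v)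

    ext-here : ∀ S p r → ext S p r p ≡ just r
    ext-here S p r with p ≟ p
    ... | yes _ = refl
    ... | no p≢p = ⊥-elim (p≢p refl)

    ext-there : ∀ S p r {v} → p ≢ v → ext S p r v ≡ S v
    ext-there S p r {v} p≢v with p ≟ v
    ... | yes p≡v = ⊥-elim (p≢v p≡v)
    ... | no _ = refl

    dom-ext-split : ∀ S p r {w} → dom (ext S p r) w → w ≡ p ⊎ dom S w
    dom-ext-split S p r {w} (r' , e) with p ≟ w
    ... | yes p≡w = inj₁ (sym p≡w)
    ... | no _ = inj₂ (r' , e)

    dom-ext-join : ∀ S p r {w} → w ≡ p ⊎ dom S w → dom (ext S p r) w
    dom-ext-join S p r (inj₁ refl) = r , ext-here S p r
    dom-ext-join S p r {w} (inj₂ (r' , e)) with p ≟ w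
    ... | yes _ = r , refl
    ... | no _ = r' , e

    ext-cong : ∀ {S S'} p r → S ≐ S' → ext S p r ≐ ext S' p r
    ext-cong p r S≐S' v with p ≟ v
    ... | yes _ = refl
    ... | no _ = S≐S' v

    ext-^ᵃ : ∀ S p r γ → (ext S p r ^ᵃ γ) ≐ ext (S ^ᵃ γ) (act p γ) r
    ext-^ᵃ S p r γ v with p ≟ act v (γ ⁻¹) | act p γ ≟ v
    ... | yes _ | yes _ = refl
    ... | yes refl | no p↦v = ⊥-elim (p↦v (act-inverseˡ v γ))
    ... | no p≢ | yes refl = ⊥-elim (p≢ (sym (act-inverseʳ p γ)))
    ... | no _ | no _ = refl

    ext-by-aut : ∀ {S p p' e} r → AutAss S e → act p e ≡ p' → ext S p' r ≐ (ext S p r ^ᵃ e)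
    ext-by-aut {S} {p} {e = e} r e∈AutS refl =
      ≐-sym (≐-trans (ext-^ᵃ S p r e) (ext-cong (act p e) r e∈AutS))

    undefined : ∀ (S : PAssign) {v} → ¬ dom S v → S v ≡ nothing
    undefined S {v} v∉S with S v
    ... | just r = ⊥-elim (v∉S (r , refl))
    ... | nothing = refl

    ext-injective : ∀ {S S' p r r'} → ¬ dom S p → ¬ dom S' p →
      ext S p r ≐ ext S' p r' → (S ≐ S') × r ≡ r'
    ext-injective {S} {S'} {p} {r} {r'} p∉S p∉S' e = same , value
      where
      same : S ≐ S'
      same v with p ≟ v
      ... | yes refl = trans (undefined S p∉S) (sym (undefined S' p∉S'))
      ... | no p≢v = trans (sym (ext-there S p r p≢v)) (trans (e v) (ext-there S' p r' p≢v))
      value : r ≡ r'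
      value = Maybe.just-injective (trans (sym (ext-here S p r)) (trans (e p) (ext-here S' p r')))

    remove : U → PAssign → PAssign
    remove p Z v with p ≟ v
    ... | yes _ = nothing
    ... | no _ = Z v

    remove-there : ∀ {Z p v} → p ≢ v → remove p Z v ≡ Z v
    remove-there {Z} {p} {v} p≢v with p ≟ v
    ... | yes p≡v = ⊥-elim (p≢v p≡v)
    ... | no _ = refl

    ext-remove : ∀ {Z p r} → Z p ≡ just r → Z ≐ ext (remove p Z) p r
    ext-remove {Z} {p} Zp≡r v with p ≟ v
    ... | yes refl = Zp≡r
    ... | no p≢v = sym (remove-there p≢v)

    remove-uj-dom : ∀ {Z} → dom Z ≐ˢ Uj → dom (remove uj Z) ≐ˢ Ujm1
    remove-uj-dom {Z} domZ v = to , from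
      where
      to : dom (remove uj Z) v → Ujm1 v
      to (r , e) with uj ≟ v | e
      ... | yes _ | ()
      ... | no uj≢v | Zv≡r with Uj-split (proj₁ (domZ v) (r , Zv≡r))
      ...   | inj₁ v≡uj = ⊥-elim (uj≢v (sym v≡uj))
      ...   | inj₂ v∈Ujm1 = v∈Ujm1
      from : Ujm1 v → dom (remove uj Z) v
      from v∈Ujm1 with uj ≟ v
      ... | yes refl = ⊥-elim (uj∉Ujm1 v∈Ujm1)
      ... | no _ = proj₂ (domZ v) (Ujm1⊆Uj v∈Ujm1)

  module Algorithm (fin : FiniteGroup G)
    {k : ℕ} (u : Fin k → U) (u-inj : Injective _≡_ _≡_ u) (j : Fin k)
    (κ : PAssign → Carrier) (canon : IsCanonicalLabeling (Step.Uj u j) κ)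
    (_≺_ : U → U → Set) (sto : IsStrictTotalOrder _≡_ _≺_)
    (ν : U → Carrier)
    (ν-spec : ∀ p → Step.Candidate u j p → AutSet (Step.Ujm1 u j) (ν p) × act p (ν p) ≡ u j)
    (𝒮 : PAssign → Set)
    (𝒮-dom : ∀ S → 𝒮 S → dom S ≐ˢ Step.Ujm1 u j)
    (𝒮-cover : ∀ Y → Ω (Step.Ujm1 u j) Y → ∃ λ S → 𝒮 S × SameOrbit S Y)
    (𝒮-unique : ∀ S S' → 𝒮 S → 𝒮 S' → SameOrbit S S' → S ≐ S') where
    open Step u j
    open Tests _≺_ κ ν 𝒮
    open StepFacts u u-inj j
    open Minima _≺_ sto
    open Finite fin
    open Orbits using (orbit-refl; orbit-trans; orbit-sym)

    WF : PAssign → U → Set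
    WF S p = (dom S ≐ˢ Ujm1) × Candidate p

    wf : ∀ {S p} → 𝒮 S → Candidate p → WF S p
    wf {S} S∈𝒮 cand = 𝒮-dom S S∈𝒮 , cand

    dom-ext : ∀ {S p} → WF S p → ∀ r → dom (ext S p r) ≐ˢ preimage Uj (ν p)
    dom-ext {S} {p} (domS , cand) r w = to , from
      where
      ν-keeps : Preserves Ujm1 (ν p)
      ν-keeps = aut⇒preserves (proj₁ (ν-spec p cand))
      p↦uj : act p (ν p) ≡ uj
      p↦uj = proj₂ (ν-spec p cand)
      to : dom (ext S p r) w → Uj (act w (ν p))
      to d with dom-ext-split S p r d
      ... | inj₁ refl = subst Uj (sym p↦uj) uj∈Uj
      ... | inj₂ w∈S = Ujm1⊆Uj (proj₂ (ν-keeps w) (proj₁ (domS w) w∈S))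
      from : Uj (act w (ν p)) → dom (ext S p r) w
      from h with Uj-split h
      ... | inj₁ w↦uj = dom-ext-join S p r (inj₁ (act-injective (ν p) (trans w↦uj (sym p↦uj))))
      ... | inj₂ wν∈Ujm1 = dom-ext-join S p r (inj₂ (proj₂ (domS w) (proj₁ (ν-keeps w) wν∈Ujm1)))

    p∉dom : ∀ {S p} → WF S p → ¬ dom S p
    p∉dom {S} {p} (domS , cand) p∈S =
      uj∉Ujm1 (subst Ujm1 (proj₂ (ν-spec p cand))
        (proj₂ (aut⇒preserves (proj₁ (ν-spec p cand)) p) (proj₁ (domS p) p∈S)))

    ext-Ω : ∀ {S p} → WF S p → ∀ r → Ω Uj (ext S p r)
    ext-Ω {S} {p} wfSp r = Ω-intro (ν p) (dom-ext wfSp r)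

    rep-dom : ∀ {S p} → WF S p → ∀ r → dom (rep S p r) ≐ˢ Uj
    rep-dom {S} {p} wfSp r = begin
      preimage (dom (ext S p r)) (ν p ⁻¹)         ≈⟨ preimage-cong (ν p ⁻¹) (dom-ext wfSp r) ⟩
      preimage (preimage Uj (ν p)) (ν p ⁻¹)       ≈⟨ preimage-inverseˡ Uj (ν p) ⟩
      Uj                                          ∎
      where open SetoidReasoning ≐ˢ-setoid

    ext-match : ∀ {S p r S' p' r' e} → WF S p → WF S' p' →
      ext S' p' r' ≐ (ext S p r ^ᵃ e) → act p e ≡ p' → (S' ≐ (S ^ᵃ e)) × r' ≡ r
    ext-match {S} {p} {r} {S'} {p'} {r'} {e} wfSp wfS'p' X'≐Xe refl =
      ext-injective (p∉dom wfS'p') p∉Se (≐-trans X'≐Xe (ext-^ᵃ S p r e))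
      where
      p∉Se : ¬ dom (S ^ᵃ e) (act p e)
      p∉Se (r₀ , e₀) = p∉dom wfSp (r₀ , trans (cong S (sym (act-inverseʳ p e))) e₀)

    Target : PAssign → U → R → U → Set
    Target S p r q = InOrbit (AutSet Uj) uj (act q ((κ (ext S p r) ⁻¹) ∙ ν p))

    Anchored : PAssign → U → R → U → Set
    Anchored S p r a = ∃ λ q → IsMinimum _≺_ (Target S p r) q
      × InOrbit (AutAss (ext S p r)) a (act q (κ (ext S p r) ⁻¹))

    target-dec : ∀ S p r q → Dec (Target S p r q)
    target-dec S p r q = orbit-dec (autSet-subgroup Uj) (autSet-dec Uj Uj-dec) uj _

    canonical-map : ∀ {S p r S' p' r'} → WF S p → WF S' p' →
      SameOrbit (ext S p r) (ext S' p' r') →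
      ext S' p' r' ≐ (ext S p r ^ᵃ (κ (ext S p r) ∙ κ (ext S' p' r') ⁻¹))
    canonical-map {S} {p} {r} {S'} {p'} {r'} wfSp wfS'p' (m , X'≐Xm) = begin
      X'                        ≈⟨ ^ᵃ-inverse X' κX' ⟨
      (X' ^ᵃ κX') ^ᵃ (κX' ⁻¹)   ≈⟨ ^ᵃ-cong (κX' ⁻¹) (canon X X' (ext-Ω wfSp r) (ext-Ω wfS'p' r') m X'≐Xm) ⟨
      (X ^ᵃ κX) ^ᵃ (κX' ⁻¹)     ≈⟨ ^ᵃ-∙ X κX (κX' ⁻¹) ⟨
      X ^ᵃ (κX ∙ κX' ⁻¹)        ∎
      where
      open SetoidReasoning ≐-setoid
      X X' : PAssign
      X = ext S p r
      X' = ext S' p' r'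
      κX κX' : Carrier
      κX = κ X
      κX' = κ X'

    target-domain : ∀ {S p} → WF S p → ∀ r →
      preimage Uj ((κ (ext S p r) ⁻¹) ∙ ν p) ≐ˢ dom (ext S p r ^ᵃ κ (ext S p r))
    target-domain {S} {p} wfSp r =
      ≐ˢ-trans (preimage-∙ Uj _ (ν p)) (preimage-cong _ (≐ˢ-sym (dom-ext wfSp r)))

    target-invariant : ∀ {S p r S' p' r'} → WF S p → WF S' p' →
      SameOrbit (ext S p r) (ext S' p' r') → ∀ q → Target S p r q → Target S' p' r' q
    target-invariant {S} {p} {r} {S'} {p'} {r'} wfSp wfS'p' X∼X' =
      orbit-retarget Uj same
      where
      same : preimage Uj ((κ (ext S p r) ⁻¹) ∙ ν p) ≐ˢ preimage Uj ((κ (ext S' p' r') ⁻¹) ∙ ν p')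
      same = ≐ˢ-trans (target-domain wfSp r)
        (≐ˢ-trans (dom-cong (canon _ _ (ext-Ω wfSp r) (ext-Ω wfS'p' r') _ (proj₂ X∼X')))
          (≐ˢ-sym (target-domain wfS'p' r')))

    anchored-transport : ∀ {S p r S' p' r' m a} → WF S p → WF S' p' →
      ext S' p' r' ≐ (ext S p r ^ᵃ m) → Anchored S p r a → Anchored S' p' r' (act a m)
    anchored-transport {S} {p} {r} {S'} {p'} {r'} {m} {a} wfSp wfS'p' X'≐Xm (q , q-min , a∼t) =
      q , minimum-cong (target-invariant wfSp wfS'p' X∼X') (target-invariant wfS'p' wfSp X'∼X) q-min
        , orbit-trans (autAss-subgroup X') (autOrbit-conj {X} X'≐Xm a∼t)
            (subst (InOrbit (AutAss X') _) t↦t' t-moves)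
      where
      X X' : PAssign
      X = ext S p r
      X' = ext S' p' r'
      X∼X' : SameOrbit X X'
      X∼X' = m , X'≐Xm
      X'∼X : SameOrbit X' X
      X'∼X = sameOrbit-sym X∼X'
      t-moves : InOrbit (AutAss X') (act (act q (κ X ⁻¹)) m) (act (act q (κ X ⁻¹)) (κ X ∙ κ X' ⁻¹))
      t-moves = autOrbit-between {X} X'≐Xm (canonical-map wfSp wfS'p' X∼X') _
      t↦t' : act (act q (κ X ⁻¹)) (κ X ∙ κ X' ⁻¹) ≡ act q (κ X' ⁻¹)
      t↦t' = trans (act-∙ _ (κ X) (κ X' ⁻¹)) (cong (λ z → act z (κ X' ⁻¹)) (act-inverseˡ q (κ X)))

    anchored-unique : ∀ {S p r a b} → Anchored S p r a → Anchored S p r b →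
      InOrbit (AutAss (ext S p r)) a b
    anchored-unique {S} {p} {r} (q , q-min , a∼t) (q' , q'-min , b∼t') =
      orbit-trans sub a∼t (orbit-sym sub (subst (λ z → InOrbit _ _ (act z _)) (sym q≡q') b∼t'))
      where
      sub : IsSubgroup (AutAss (ext S p r))
      sub = autAss-subgroup (ext S p r)
      q≡q' : q ≡ q'
      q≡q' = minimum-unique q-min q'-min

    anchored-align : ∀ {S p r S' p' r' a a'} → WF S p → WF S' p' →
      SameOrbit (ext S p r) (ext S' p' r') → Anchored S p r a → Anchored S' p' r' a' →
      ∃ λ e → ext S' p' r' ≐ (ext S p r ^ᵃ e) × act a e ≡ a'
    anchored-align {S} {p} {r} {S'} {p'} {r'} wfSp wfS'p' (m , X'≐Xm) anchor anchor' =
      autOrbit-align {ext S p r} X'≐Xm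
        (anchored-unique {S'} {p'} {r'} (anchored-transport wfSp wfS'p' X'≐Xm anchor) anchor')

    -- Accepted triples whose extensions are matched by some e coincide: e carries
    -- S to S' ∈ 𝒮, hence S = S' and e ∈ Aut(S), so (T2') forces p = p'.
    aligned-accepted-equal : ∀ {S p r S' p' r'} → Accepted S p r → Accepted S' p' r' →
      (∃ λ e → ext S' p' r' ≐ (ext S p r ^ᵃ e) × act p e ≡ p') → (S ≐ S') × p ≡ p' × r ≡ r'
    aligned-accepted-equal {S} {p} {r} {S'} {p'} {r'}
      (S∈𝒮 , cand , _ , t2) (S'∈𝒮 , cand' , _ , t2') (e , X'≐Xe , p↦p') =
      S≐S' , p≡p' , sym (proj₂ matched)
      where
      matched : (S' ≐ (S ^ᵃ e)) × r' ≡ r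
      matched = ext-match {S} {p} {r} {S'} {p'} {r'} (wf S∈𝒮 cand) (wf S'∈𝒮 cand') X'≐Xe p↦p'
      S≐S' : S ≐ S'
      S≐S' = 𝒮-unique S S' S∈𝒮 S'∈𝒮 (e , proj₁ matched)
      e∈AutS : AutAss S e
      e∈AutS = ≐-trans (≐-sym (proj₁ matched)) (≐-sym S≐S')
      t2'-on-S : IsMinimum _≺_ (InOrbit (AutAss S) p') p'
      t2'-on-S = minimum-cong (λ _ → autOrbit-cong (≐-sym S≐S')) (λ _ → autOrbit-cong S≐S') t2'
      p≡p' : p ≡ p'
      p≡p' = orbit-minimum-unique (autAss-subgroup S) (e , e∈AutS , p↦p') t2 t2'-on-S

    accepted-unique : ∀ Y S p r S' p' r' → Accepted S p r → Accepted S' p' r' →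
      SameOrbit (rep S p r) Y → SameOrbit (rep S' p' r') Y → (S ≐ S') × p ≡ p' × r ≡ r'
    accepted-unique Y S p r S' p' r' acc@(S∈𝒮 , cand , t1 , _) acc'@(S'∈𝒮 , cand' , t1' , _) rep∼Y rep'∼Y =
      aligned-accepted-equal acc acc'
        (anchored-align {S} {p} {r} {S'} {p'} {r'} (wf S∈𝒮 cand) (wf S'∈𝒮 cand') X∼X' t1 t1')
      where
      X∼X' : SameOrbit (ext S p r) (ext S' p' r')
      X∼X' = begin
        ext S p r      ≈⟨ ν p , ≐-refl ⟩
        rep S p r      ≈⟨ rep∼Y ⟩
        Y              ≈⟨ rep'∼Y ⟨
        rep S' p' r'   ≈⟨ ν p' , ≐-refl ⟨
        ext S' p' r'   ∎
        where open OrbitReasoning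

    -- Every Z normalized on U_j is in the orbit of some X_{S,p,r}, S ∈ 𝒮, by a
    -- map sending p to u_j: remove u_j, normalize the rest in 𝒮, and extend back.
    normal-form : ∀ Z → dom Z ≐ˢ Uj → ∃ λ S → ∃ λ p → ∃ λ r → ∃ λ g →
      𝒮 S × Candidate p × Z ≐ (ext S p r ^ᵃ g) × act p g ≡ uj
    normal-form Z domZ
      with proj₂ (domZ uj) uj∈Uj
         | 𝒮-cover (remove uj Z) (Ω-intro ε (≐ˢ-trans (remove-uj-dom domZ) (≐ˢ-sym (preimage-ε Ujm1))))
    ... | r , Zuj≡r | S , S∈𝒮 , δ , Z⁻≐Sδ =
      S , act uj (δ ⁻¹) , r , δ , S∈𝒮 , candidate , Z≐ , act-inverseˡ uj δ
      where
      candidate : Candidate (act uj (δ ⁻¹))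
      candidate = δ ⁻¹
        , domain-aut {S} (𝒮-dom S S∈𝒮) (≐ˢ-trans (dom-cong (≐-sym Z⁻≐Sδ)) (remove-uj-dom domZ))
        , refl
      Z≐ : Z ≐ (ext S (act uj (δ ⁻¹)) r ^ᵃ δ)
      Z≐ = begin
        Z                                          ≈⟨ ext-remove Zuj≡r ⟩
        ext (remove uj Z) uj r                     ≈⟨ ext-cong uj r Z⁻≐Sδ ⟩
        ext (S ^ᵃ δ) uj r                          ≡⟨ cong (λ x → ext (S ^ᵃ δ) x r) (act-inverseˡ uj δ) ⟨
        ext (S ^ᵃ δ) (act (act uj (δ ⁻¹)) δ) r     ≈⟨ ext-^ᵃ S (act uj (δ ⁻¹)) r δ ⟨
        ext S (act uj (δ ⁻¹)) r ^ᵃ δ               ∎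
        where open SetoidReasoning ≐-setoid

    -- Making (T1') hold: move X so that its anchor t = q^{κ(X)⁻¹} goes to u_j,
    -- then renormalize; the anchor becomes the extension point.
    fix-T1 : ∀ {S p r Y} → 𝒮 S → Candidate p → SameOrbit (ext S p r) Y → ∃ λ S' → ∃ λ p' → ∃ λ r' →
      𝒮 S' × Candidate p' × T1 S' p' r' × SameOrbit (ext S' p' r') Y
    fix-T1 {S} {p} {r} {Y} S∈𝒮 cand X∼Y =
      case minimum-exists (Target S p r) (target-dec S p r) _ uj-target of λ
      { (q , q-min@((β , β∈AutUj , uj↦) , _)) →
        case normal-form ((rep S p r) ^ᵃ (β ⁻¹))
               (dom-^ᵃ-aut (rep-dom (wf S∈𝒮 cand) r) (IsSubgroup.has-⁻¹ (autSet-subgroup Uj) β∈AutUj)) of λ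
        { (S' , p' , r' , g , S'∈𝒮 , cand' , Z≐ , p'↦uj) →
          let X'≐Xm : ext S' p' r' ≐ (ext S p r ^ᵃ ((ν p ∙ β ⁻¹) ∙ g ⁻¹))
              X'≐Xm = ^ᵃ-path {ext S p r} {ext S' p' r'} (ν p) (β ⁻¹) g (≐-sym Z≐)
              t↦p' : act (act q (κ (ext S p r) ⁻¹)) ((ν p ∙ β ⁻¹) ∙ g ⁻¹) ≡ p'
              t↦p' = act-path (ν p) β g (trans (sym (act-∙ q _ (ν p))) (sym uj↦)) p'↦uj
          in S' , p' , r' , S'∈𝒮 , cand'
             , subst (Anchored S' p' r') t↦p'
                 (anchored-transport {S} {p} {r} {S'} {p'} {r'} (wf S∈𝒮 cand) (wf S'∈𝒮 cand') X'≐Xm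
                   (q , q-min , orbit-refl (autAss-subgroup (ext S p r)) _))
             , (let open OrbitReasoning in begin
                 ext S' p' r'   ≈⟨ _ , X'≐Xm ⟨
                 ext S p r      ≈⟨ X∼Y ⟩
                 Y              ∎) } }
      where
      -- With c = κ(X)⁻¹ν(p), the point u_j^{c⁻¹} satisfies the predicate of (T1')
      -- (take the identity of Aut(U_j)), so that predicate has a minimum.
      uj-target : Target S p r (act uj (((κ (ext S p r) ⁻¹) ∙ ν p) ⁻¹))
      uj-target = ε , IsSubgroup.has-ε (autSet-subgroup Uj) , trans (act-ε uj) (sym (act-inverseˡ uj _))

    -- Making (T2') hold: replace p by the minimum p' of p^{Aut(S)}; this moves X
    -- by an automorphism of S, which keeps p' a candidate and keeps (T1').
    fix-T2 : ∀ {S p r Y} → 𝒮 S → Candidate p → T1 S p r → SameOrbit (ext S p r) Y →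
      ∃ λ p' → Accepted S p' r × SameOrbit (rep S p' r) Y
    fix-T2 {S} {p} {r} {Y} S∈𝒮 cand t1 X∼Y =
      case minimum-exists (InOrbit (AutAss S) p) (orbit-dec (autAss-subgroup S) (autAss-dec S) p) p
             (orbit-refl (autAss-subgroup S) p) of λ
      { (p' , p'-min@(p∼p'@(e , e∈AutS , p↦p') , _)) →
        let X'≐Xe : ext S p' r ≐ (ext S p r ^ᵃ e)
            X'≐Xe = ext-by-aut r e∈AutS p↦p'
            cand' : Candidate p'
            cand' = orbit-trans (autSet-subgroup Ujm1) cand (e , aut-domain {S} (𝒮-dom S S∈𝒮) e∈AutS , p↦p')
        in p'
           , ( S∈𝒮 , cand'
             , subst (Anchored S p' r) p↦p'
                 (anchored-transport {S} {p} {r} {S} {p'} {r} (wf S∈𝒮 cand) (wf S∈𝒮 cand') X'≐Xe t1)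
             , orbit-minimum-move (autAss-subgroup S) p∼p' p'-min )
           , (let open OrbitReasoning in begin
               rep S p' r     ≈⟨ ν p' , ≐-refl ⟨
               ext S p' r     ≈⟨ e , X'≐Xe ⟨
               ext S p r      ≈⟨ X∼Y ⟩
               Y              ∎) }

    accepted-exists : ∀ Y → Ω Uj Y →
      ∃ λ S → ∃ λ p → ∃ λ r → Accepted S p r × SameOrbit (rep S p r) Y
    accepted-exists Y (γ , domY) =
      case normal-form (Y ^ᵃ (γ ⁻¹)) (Ω-normalize domY) of λ
      { (S₀ , p₀ , r₀ , g₀ , S₀∈𝒮 , cand₀ , Y'≐X₀g₀ , _) →
        case fix-T1 S₀∈𝒮 cand₀ (let open OrbitReasoning in begin
               ext S₀ p₀ r₀   ≈⟨ g₀ , Y'≐X₀g₀ ⟩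
               Y ^ᵃ (γ ⁻¹)    ≈⟨ γ ⁻¹ , ≐-refl ⟨
               Y              ∎) of λ
        { (S₁ , p₁ , r₁ , S₁∈𝒮 , cand₁ , t1 , X₁∼Y) →
          case fix-T2 S₁∈𝒮 cand₁ t1 X₁∼Y of λ
          { (p₂ , accepted , rep∼Y) → S₁ , p₂ , r₁ , accepted , rep∼Y } } }

mainTheorem1 : (G : Group 0ℓ 0ℓ) → FiniteGroup G →
    (nU nR k : ℕ) (A : RightAction G nU) →
    (u : Fin k → Fin nU) → Injective _≡_ _≡_ u →
    (j : Fin k) →
    (κ : Ctx.PAssign nR A → Group.Carrier G) →
    Ctx.IsCanonicalLabeling nR A (Ctx.Step.Uj nR A u j) κ →
    (_≺_ : Fin nU → Fin nU → Set) → IsStrictTotalOrder _≡_ _≺_ →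
    (ν : Fin nU → Group.Carrier G) →
    (∀ p → Ctx.Step.Candidate nR A u j p →
    Ctx.AutSet nR A (Ctx.Step.Ujm1 nR A u j) (ν p)
    × RightAction.act A p (ν p) ≡ u j) →
    (𝒮 : Ctx.PAssign nR A → Set) →
    (∀ S → 𝒮 S → Ctx._≐ˢ_ nR A (Ctx.dom nR A S) (Ctx.Step.Ujm1 nR A u j)) →
    (∀ Y → Ctx.Ω nR A (Ctx.Step.Ujm1 nR A u j) Y →
    ∃ λ S → 𝒮 S × Ctx.SameOrbit nR A S Y) →
    (∀ S S' → 𝒮 S → 𝒮 S' → Ctx.SameOrbit nR A S S' → Ctx._≐_ nR A S S') →
    (∀ S p r → Ctx.Step.Tests.Accepted nR A u j _≺_ κ ν 𝒮 S p r →
    Ctx._≐ˢ_ nR A (Ctx.dom nR A (Ctx.Step.Tests.rep nR A u j _≺_ κ ν 𝒮 S p r))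
    (Ctx.Step.Uj nR A u j))
    ×
    (∀ Y → Ctx.Ω nR A (Ctx.Step.Uj nR A u j) Y →
    (∃ λ S → ∃ λ p → ∃ λ r →
    Ctx.Step.Tests.Accepted nR A u j _≺_ κ ν 𝒮 S p r
    × Ctx.SameOrbit nR A (Ctx.Step.Tests.rep nR A u j _≺_ κ ν 𝒮 S p r) Y)
    ×
    (∀ S p r S' p' r' →
    Ctx.Step.Tests.Accepted nR A u j _≺_ κ ν 𝒮 S p r →
    Ctx.Step.Tests.Accepted nR A u j _≺_ κ ν 𝒮 S' p' r' →
    Ctx.SameOrbit nR A (Ctx.Step.Tests.rep nR A u j _≺_ κ ν 𝒮 S p r) Y →
    Ctx.SameOrbit nR A (Ctx.Step.Tests.rep nR A u j _≺_ κ ν 𝒮 S' p' r') Y →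
    Ctx._≐_ nR A S S' × p ≡ p' × r ≡ r'))
mainTheorem1 G fin nU nR k A u u-inj j κ canon _≺_ sto ν ν-spec 𝒮 𝒮-dom 𝒮-cover 𝒮-unique =
  (λ S p r (S∈𝒮 , cand , _) → rep-dom (wf S∈𝒮 cand) r)
  , λ Y ΩY → accepted-exists Y ΩY , accepted-unique Y
  where
  open Theory G nR A
  open Algorithm fin u u-inj j κ canon _≺_ sto ν ν-spec 𝒮 𝒮-dom 𝒮-cover 𝒮-unique
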